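{- Let $S_1$ be the map on the orientable surface determined by the following rotation system on the 13 vertices $a,b,\dots,m$, where each vertex is followed by the list of its neighbours in cyclic order: $a: b,c,d,e$; $b: a,f,g,h$; $c: a,h,i,j$; $d: a,j,k,l$; $e: a,l,m,f$; $f: b,e,j,i$; $g: b,i,m,l$; $h: b,l,k,c$; $i: c,k,g,f$; $j: c,f,m,d$; $k: d,m,i,h$; $l: d,h,g,e$; $m: e,g,k,j$. Then $S_1$ is a polyhedral map on the torus, and it is diminimal.
   Context: All graphs are simple (no loops, no multiple edges). A rotation system (cyclic order of neighbours at each vertex) determines a cellular embedding of the graph in an orientable surface, whose faces are traced by the rotations. If $G$ is a graph embedded in a surface, the closure of each connected component of the complement of the graph is a face. An embedded graph is a map if every vertex has degree at least 3 and every face is a closed 2-cell. Two distinct faces meet properly if their intersection is empty, a single vertex, or a single edge. A map is polyhedral if every face is simply connected and every pair of distinct faces meets properly; a toroidal polyhedral map (TPM) is a polyhedral map on the torus. Edge removing: delete an edge $e$; if this creates a vertex of degree 2, the two edges at that vertex are merged into one edge. Edge $e$ of a TPM is removable if the resulting map is again a TPM. Edge shrinking: contract $e$ so its two endpoints become one vertex; if a two-sided face is created, its two edges are replaced by a single edge. Edge $e$ of a TPM is shrinkable if the resulting map is again a TPM. A TPM is diminimal if it has no removable edges and no shrinkable edges. -}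

module Defs where

open import Data.Nat using (ℕ; zero; suc; _+_; _*_; _≤ᵇ_)
open import Data.Nat.DivMod using (_mod_)
open import Data.Bool using (Bool; true; false; _∧_; not; if_then_else_; T)
open import Data.Fin using (Fin; toℕ; combine; remQuot; #_)
open import Data.Fin.Properties using (_≟_)
open import Data.Vec using (Vec; []; _∷_; lookup)
open import Data.List using (length; filterᵇ; allFin)
open import Data.Maybe using (Maybe; just; nothing; fromMaybe)
open import Data.Product using (Σ; _×_; _,_)
open import Data.Sum using (_⊎_)
open import Relation.Nullary using (¬_; does)
open import Relation.Binary.PropositionalEquality using (_≡_; _≢_)

-- A dart is a directed half-edge.  live marks the darts that exist
-- (this lets edge operations delete darts without re-indexing),
-- α is the edge involution (dart ↦ reverse dart),
-- σ is the rotation (next dart around the tail vertex),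
-- φ = σ ∘ α is the face permutation (faces = φ-orbits),
-- vertices = σ-orbits, edges = α-orbits.

record PreMap (N : ℕ) : Set where
  constructor premap
  field
    live : Fin N → Bool
    α    : Fin N → Fin N
    σ    : Fin N → Fin N

  φ : Fin N → Fin N
  φ x = σ (α x)

open PreMap public

iter : {A : Set} → (A → A) → ℕ → A → A
iter f zero    x = x
iter f (suc k) x = f (iter f k x)

_==_ : ∀ {N} → Fin N → Fin N → Bool
x == y = does (x ≟ y)

count : ∀ {N} → (Fin N → Bool) → ℕ
count {N} p = length (filterᵇ p (allFin N))

module _ {N : ℕ} (M : PreMap N) where

  Live : Fin N → Set
  Live x = T (live M x)

  -- y lies in the orbit of x under f (orbits have length ≤ N)
  SameOrbit : (Fin N → Fin N) → Fin N → Fin N → Set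
  SameOrbit f x y = Σ (Fin N) λ k → iter f (toℕ k) x ≡ y

  SameVertex : Fin N → Fin N → Set
  SameVertex = SameOrbit (σ M)

  SameFace : Fin N → Fin N → Set
  SameFace = SameOrbit (φ M)

  -- x is the least dart of its f-orbit (orbit representative)
  isRep : (Fin N → Fin N) → Fin N → Bool
  isRep f x = go N (f x)
    where
    go : ℕ → Fin N → Bool
    go zero    y = true
    go (suc n) y = (toℕ x ≤ᵇ toℕ y) ∧ go n (f y)

  #V #E #F : ℕ
  #V = count (λ x → live M x ∧ isRep (σ M) x)
  #E = count (λ x → live M x ∧ (toℕ x ≤ᵇ toℕ (α M x)))
  #F = count (λ x → live M x ∧ isRep (φ M) x)

  data Connected : Fin N → Fin N → Set where
    here : ∀ {x} → Connected x x
    viaα : ∀ {x y} → Connected (α M x) y → Connected x y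
    viaσ : ∀ {x y} → Connected (σ M x) y → Connected x y

  -- Two faces F1 ∋ x, F2 ∋ y (as closed sets) meet properly:
  -- their intersection is empty, a single vertex, or a single edge.
  CommonVertex : Fin N → Fin N → Fin N → Fin N → Set
  CommonVertex x y x' y' = SameFace x x' × SameFace y y' × SameVertex x' y'

  SharedEdge : Fin N → Fin N → Fin N → Set
  SharedEdge x y x' = SameFace x x' × SameFace y (α M x')

  MeetProperly : Fin N → Fin N → Set
  MeetProperly x y =
      (∀ x' y' → ¬ CommonVertex x y x' y')
    ⊎ (Σ (Fin N) λ x0 → Σ (Fin N) λ y0 → CommonVertex x y x0 y0
         × (∀ x' y' → CommonVertex x y x' y' → SameVertex x' x0)
         × (∀ x' → ¬ SharedEdge x y x'))
    ⊎ (Σ (Fin N) λ x0 → SharedEdge x y x0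
         × (∀ x' → SharedEdge x y x' → x' ≡ x0)
         × (∀ x' y' → CommonVertex x y x' y' → SameVertex x' x0 ⊎ SameVertex x' (α M x0)))

-- Toroidal polyhedral map: a simple connected graph with a rotation
-- system (hence orientable cellular embedding) of Euler characteristic 0,
-- all degrees ≥ 3, every face a closed 2-cell (its boundary walk visits
-- no vertex twice), and any two distinct faces meeting properly.
record IsTPM {N : ℕ} (M : PreMap N) : Set where
  field
    nonempty      : Σ (Fin N) (Live M)
    α-live        : ∀ x → Live M x → Live M (α M x)
    σ-live        : ∀ x → Live M x → Live M (σ M x)
    α-involution  : ∀ x → Live M x → α M (α M x) ≡ x
    α-no-fixpoint : ∀ x → Live M x → α M x ≢ x
    σ-injective   : ∀ x y → Live M x → Live M y → σ M x ≡ σ M y → x ≡ y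
    connected     : ∀ x y → Live M x → Live M y → Connected M x y
    no-loops      : ∀ x → Live M x → ¬ SameVertex M x (α M x)
    no-multi-edges : ∀ x y → Live M x → Live M y →
                     SameVertex M x y → SameVertex M (α M x) (α M y) → x ≡ y
    torus         : #V M + #F M ≡ #E M
    degree≥3      : ∀ x → Live M x → (σ M x ≢ x) × (σ M (σ M x) ≢ x)
    faces-closed-2-cells : ∀ x y → Live M x → SameFace M x y → SameVertex M x y → x ≡ y
    faces-meet-properly  : ∀ x y → Live M x → Live M y → ¬ SameFace M x y → MeetProperly M x y

nextLive : ∀ {N} → ℕ → (Fin N → Bool) → (Fin N → Fin N) → Fin N → Fin N
nextLive zero    L f x = f x
nextLive (suc k) L f x = if L (f x) then f x else nextLive k L f (f x)

-- Edge removing: delete the edge {d, α d}; then every vertex of degree 2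
-- is suppressed (its two edges merged into one edge).
removeEdge : ∀ {N} → PreMap N → Fin N → PreMap N
removeEdge {N} M d = premap live₂ α₂ σ₁
  where
  live₁ : Fin N → Bool
  live₁ x = live M x ∧ not (x == d) ∧ not (x == α M d)
  σ₁ : Fin N → Fin N
  σ₁ = nextLive N live₁ (σ M)
  deg2 : Fin N → Bool
  deg2 x = live₁ x ∧ (σ₁ (σ₁ x) == x) ∧ not (σ₁ x == x)
  live₂ : Fin N → Bool
  live₂ x = live₁ x ∧ not (deg2 x)
  α₂ : Fin N → Fin N
  α₂ x = if deg2 (α M x) then α M (σ₁ (α M x)) else α M x

-- Edge shrinking: contract the edge {d, α d} (splicing the rotations of
-- its ends); then every two-sided face has its two edges replaced by one.
shrinkEdge : ∀ {N} → PreMap N → Fin N → PreMap N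
shrinkEdge {N} M d = premap live₂ α₂ σ₂
  where
  e = α M d
  live₁ : Fin N → Bool
  live₁ x = live M x ∧ not (x == d) ∧ not (x == e)
  σ₁ : Fin N → Fin N
  σ₁ x = if σ M x == d then σ M e else (if σ M x == e then σ M d else σ M x)
  φ₁ : Fin N → Fin N
  φ₁ x = σ₁ (α M x)
  digon : Fin N → Bool
  digon x = live₁ x ∧ (φ₁ (φ₁ x) == x) ∧ not (φ₁ x == x)
  live₂ : Fin N → Bool
  live₂ x = live₁ x ∧ not (digon x)
  σ₂ : Fin N → Fin N
  σ₂ = nextLive N live₂ σ₁
  α₂ : Fin N → Fin N
  α₂ x = if digon (α M x) then α M (φ₁ (α M x)) else α M x

Removable : ∀ {N} → PreMap N → Fin N → Set
Removable M d = IsTPM (removeEdge M d)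

Shrinkable : ∀ {N} → PreMap N → Fin N → Set
Shrinkable M d = IsTPM (shrinkEdge M d)

Diminimal : ∀ {N} → PreMap N → Set
Diminimal M = (∀ d → Live M d → ¬ Removable M d) × (∀ d → Live M d → ¬ Shrinkable M d)

-- The map determined by a (k+1)-regular rotation system on Fin n:
-- dart (v , i) = the i-th entry of v's cyclic neighbour list.

indexOf : ∀ {n m} → Fin n → Vec (Fin n) m → Maybe (Fin m)
indexOf v [] = nothing
indexOf v (w ∷ ws) = if v == w then just Fin.zero else Data.Maybe.map Fin.suc (indexOf v ws)
  where import Data.Fin as Fin
        import Data.Maybe

fromRotation : ∀ {n} (k : ℕ) → (Fin n → Vec (Fin n) (suc k)) → PreMap (n * suc k)
fromRotation {n} k R = premap (λ _ → true) αR σR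
  where
  σR : Fin (n * suc k) → Fin (n * suc k)
  σR x with remQuot {n} (suc k) x
  ... | v , i = combine v ((suc (toℕ i)) mod (suc k))
  αR : Fin (n * suc k) → Fin (n * suc k)
  αR x with remQuot {n} (suc k) x
  ... | v , i = let w = lookup (R v) i in combine w (fromMaybe (# 0) (indexOf v (R w)))

a b c d e f g h i j k l m : Fin 13
a = # 0
b = # 1
c = # 2
d = # 3
e = # 4
f = # 5
g = # 6
h = # 7
i = # 8
j = # 9
k = # 10
l = # 11
m = # 12

rotS₁ : Fin 13 → Vec (Fin 13) 4
rotS₁ x = lookup table x
  where
  table : Vec (Vec (Fin 13) 4) 13
  table = (b ∷ c ∷ d ∷ e ∷ [])
        ∷ (a ∷ f ∷ g ∷ h ∷ [])
        ∷ (a ∷ h ∷ i ∷ j ∷ [])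
        ∷ (a ∷ j ∷ k ∷ l ∷ [])
        ∷ (a ∷ l ∷ m ∷ f ∷ [])
        ∷ (b ∷ e ∷ j ∷ i ∷ [])
        ∷ (b ∷ i ∷ m ∷ l ∷ [])
        ∷ (b ∷ l ∷ k ∷ c ∷ [])
        ∷ (c ∷ k ∷ g ∷ f ∷ [])
        ∷ (c ∷ f ∷ m ∷ d ∷ [])
        ∷ (d ∷ m ∷ i ∷ h ∷ [])
        ∷ (d ∷ h ∷ g ∷ e ∷ [])
        ∷ (e ∷ g ∷ k ∷ j ∷ [])
        ∷ []

S₁ : PreMap (13 * 4)
S₁ = fromRotation 3 rotS₁

module Submission where

-- S₁ is given by an explicit rotation system on 52 darts, so every claim is a
-- finite statement; the proof reduces each of them to Boolean checks that Agda
-- evaluates, together with lemmas saying what a passing check means.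
--
-- Two distinct faces sharing two different vertices but no
--   edge do not meet properly, so a map containing them is not a TPM.  A table
--   gives such a pair of faces for every edge removal and edge shrinking of S₁.
-- * Positive criterion.  For a map whose darts all lie on closed σ- and
--   φ-cycles, every field of IsTPM follows from a check over all darts:
--   connectivity from a "next hop" rule leading each dart to a root (Connected
--   is symmetric here), meeting properly from a decision procedure applied to
--   the least dart of each face (meeting properly depends only on the faces).
-- * The theorem combines the criterion for S₁ with the two obstruction tables.

open import Defs
open import Data.Bool using (Bool; true; false; _∧_; _∨_; not; if_then_else_; T)
open import Data.Bool.ListAction using (all; any)
open import Data.Empty using (⊥-elim)
open import Data.Fin using (Fin; toℕ; fromℕ<; #_)
open import Data.Fin.Properties using (_≟_; toℕ-fromℕ<)
open import Data.List using (List; []; _∷_; allFin; length)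
open import Data.List.Membership.Propositional using (_∈_; find)
open import Data.List.Membership.Propositional.Properties using (∈-allFin)
import Data.List.Relation.Unary.All as All
open import Data.List.Relation.Unary.All.Properties using (all⁺)
open import Data.List.Relation.Unary.Any as Any using (here; there)
open import Data.List.Relation.Unary.Any.Properties using (any⁺; any⁻)
open import Data.Nat using (ℕ; zero; suc; _+_; _∸_; _<_; _≤_; _≤ᵇ_; _%_; _≡ᵇ_; z≤n; s≤s)
open import Data.Nat.Properties using (≤ᵇ⇒≤; ≤-trans; ≤∧≢⇒<; m∸n+n≡m; <⇒≤)
import Data.Nat.Properties as ℕ
open import Data.Product using (Σ; _×_; _,_; proj₁; proj₂)
open import Data.Sum using (_⊎_; inj₁; inj₂; [_,_])
open import Data.Vec using (Vec; lookup; _∷_; [])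
open import Function using (_∘_)
open import Function.Bundles using (_⇔_; mk⇔; Equivalence)
open import Relation.Nullary using (¬_; yes; no)
open import Relation.Binary.PropositionalEquality
  using (_≡_; _≢_; refl; sym; trans; cong; subst; subst₂; module ≡-Reasoning)

==-sound : ∀ {N} {x y : Fin N} → T (x == y) → x ≡ y
==-sound {x = x} {y} t with x ≟ y
... | yes x≡y = x≡y
... | no _ = ⊥-elim t

==-complete : ∀ {N} {x y : Fin N} → x ≡ y → T (x == y)
==-complete {x = x} refl with x ≟ x
... | yes _ = _
... | no x≢x = x≢x refl

∧-intro : ∀ {u v} → T u → T v → T (u ∧ v)
∧-intro {true} _ t = t

∧-elim : ∀ {u v} → T (u ∧ v) → T u × T v
∧-elim {true} t = _ , t

∨-elim : ∀ {u v} → T (u ∨ v) → T u ⊎ T v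
∨-elim {true} _ = inj₁ _
∨-elim {false} t = inj₂ t

not-elim : ∀ {u} → T (not u) → ¬ T u
not-elim {false} _ ()

infixr 4 _⇒ᵇ_
_⇒ᵇ_ : Bool → Bool → Bool
u ⇒ᵇ v = not u ∨ v

⇒ᵇ-elim : ∀ {u v} → T (u ⇒ᵇ v) → T u → T v
⇒ᵇ-elim {true} t _ = t

infix 10 _∈ᵇ_
_∈ᵇ_ : ∀ {N} → Fin N → List (Fin N) → Bool
x ∈ᵇ xs = any (x ==_) xs

∈ᵇ-sound : ∀ {N} {x : Fin N} {xs} → T (x ∈ᵇ xs) → x ∈ xs
∈ᵇ-sound {x = x} {xs} t = Any.map ==-sound (any⁻ (x ==_) xs t)

∈ᵇ-complete : ∀ {N} {x : Fin N} {xs} → x ∈ xs → T (x ∈ᵇ xs)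
∈ᵇ-complete {x = x} x∈xs = any⁺ (x ==_) (Any.map ==-complete x∈xs)

all-elim : ∀ {A : Set} (p : A → Bool) {xs x} → T (all p xs) → x ∈ xs → T (p x)
all-elim p {xs} t = All.lookup (all⁺ p xs t)

any-elim : ∀ {A : Set} (p : A → Bool) {xs} → T (any p xs) → Σ A λ x → x ∈ xs × T (p x)
any-elim p {xs} t = find (any⁻ p xs t)

everyDart : ∀ {N} → (Fin N → Bool) → Bool
everyDart {N} p = all p (allFin N)

everyDart-elim : ∀ {N} (p : Fin N → Bool) → T (everyDart p) → ∀ x → T (p x)
everyDart-elim p t x = all-elim p t (∈-allFin x)

iter-suc : ∀ {A : Set} (f : A → A) k x → iter f (suc k) x ≡ iter f k (f x)
iter-suc f zero x = refl
iter-suc f (suc k) x = cong f (iter-suc f k x)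

iter-+ : ∀ {A : Set} (f : A → A) m n x → iter f (m + n) x ≡ iter f m (iter f n x)
iter-+ f zero n x = refl
iter-+ f (suc m) n x = cong f (iter-+ f m n x)

iter-ext : ∀ {A : Set} {f g : A → A} → (∀ z → f z ≡ g z) → ∀ k x → iter f k x ≡ iter g k x
iter-ext f≗g zero x = refl
iter-ext {f = f} f≗g (suc k) x = trans (cong f (iter-ext f≗g k x)) (f≗g _)

reduce : ∀ {A : Set} (f : A → A) {P x} → iter f (suc P) x ≡ x →
         ∀ k → Σ ℕ λ r → r < suc P × iter f k x ≡ iter f r x
reduce f p zero = zero , s≤s z≤n , refl
reduce f {P} {x} p (suc k) with reduce f p k
... | r , r<1+P , eq with suc r ℕ.≟ suc P
...   | yes 1+r≡1+P = zero , s≤s z≤n , trans (cong f eq) (trans (cong (λ n → iter f n x) 1+r≡1+P) p)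
...   | no 1+r≢1+P = suc r , ≤∧≢⇒< r<1+P 1+r≢1+P , cong f eq

orbit : ∀ {A : Set} → (A → A) → ℕ → A → List A
orbit f zero x = []
orbit f (suc n) x = x ∷ orbit f n (f x)

iter-∈-orbit : ∀ {A : Set} (f : A → A) {n r} x → r < n → iter f r x ∈ orbit f n x
iter-∈-orbit f {suc n} {zero} x _ = here refl
iter-∈-orbit f {suc n} {suc r} x (s≤s r<n) =
  there (subst (_∈ orbit f n (f x)) (sym (iter-suc f r x)) (iter-∈-orbit f (f x) r<n))

∈-orbit-iter : ∀ {A : Set} (f : A → A) {n x y} → y ∈ orbit f n x → Σ ℕ λ r → r < n × iter f r x ≡ y
∈-orbit-iter f {suc n} (here y≡x) = zero , s≤s z≤n , sym y≡x
∈-orbit-iter f {suc n} {x} (there y∈) with ∈-orbit-iter f y∈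
... | r , r<n , eq = suc r , s≤s r<n , trans (iter-suc f r x) eq

lastOf : ∀ {A : Set} → A → List A → A
lastOf z [] = z
lastOf z (w ∷ ws) = lastOf w ws

lastOf-orbit : ∀ {A : Set} (f : A → A) n x → lastOf x (orbit f (suc n) x) ≡ iter f n x
lastOf-orbit f zero x = refl
lastOf-orbit f (suc n) x = trans (lastOf-orbit f n (f x)) (sym (iter-suc f n x))

trip : ∀ {N} → (Fin N → Fin N) → Fin N → ℕ → Fin N → List (Fin N)
trip f x zero y = []
trip f x (suc n) y = if y == x then [] else y ∷ trip f x n (f y)

trip-orbit : ∀ {N} (f : Fin N → Fin N) x n y → trip f x n y ≡ orbit f (length (trip f x n y)) y
trip-orbit f x zero y = refl
trip-orbit f x (suc n) y with y == x
... | true = refl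
... | false = cong (y ∷_) (trip-orbit f x n (f y))

-- The cycle of x under f, computed in one pass (each iterate is evaluated once);
-- whether it really closes up is checked separately (`closedᵇ` below).
cycle : ∀ {N} → (Fin N → Fin N) → Fin N → List (Fin N)
cycle {N} f x = x ∷ trip f x N (f x)

period : ∀ {N} → (Fin N → Fin N) → Fin N → ℕ
period {N} f x = length (trip f x N (f x))

cycle-orbit : ∀ {N} (f : Fin N → Fin N) x → cycle f x ≡ orbit f (suc (period f x)) x
cycle-orbit {N} f x = cong (x ∷_) (trip-orbit f x N (f x))

-- Orbits of a map as lists.  `f` is one of the permutations of M and `fast`
-- a pointwise equal function used for evaluation.

module CycleList {N : ℕ} (M : PreMap N) (f fast : Fin N → Fin N) (f≗ : ∀ z → f z ≡ fast z) where

  cycleOf : Fin N → List (Fin N)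
  cycleOf = cycle fast

  closedᵇ : Fin N → List (Fin N) → Bool
  closedᵇ x L = (length L ≤ᵇ N) ∧ (fast (lastOf x L) == x)

  -- x lies on an f-cycle of length ≤ N, namely cycleOf x.
  Closed : Fin N → Set
  Closed x = T (closedᵇ x (cycleOf x))

  length≤N : ∀ {x} → Closed x → suc (period fast x) ≤ N
  length≤N {x} c = ≤ᵇ⇒≤ (length (cycleOf x)) N (proj₁ (∧-elim c))

  returns : ∀ {x} → Closed x → iter f (suc (period fast x)) x ≡ x
  returns {x} c = begin
    iter f (suc P) x                          ≡⟨ iter-ext f≗ (suc P) x ⟩
    fast (iter fast P x)                      ≡⟨ cong fast (sym (lastOf-orbit fast P x)) ⟩
    fast (lastOf x (orbit fast (suc P) x))    ≡⟨ cong (fast ∘ lastOf x) (sym (cycle-orbit fast x)) ⟩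
    fast (lastOf x (cycleOf x))               ≡⟨ ==-sound (proj₂ (∧-elim c)) ⟩
    x                                         ∎
    where
    open ≡-Reasoning
    P = period fast x

  reach⇒∈ : ∀ {x y} → Closed x → ∀ k → iter f k x ≡ y → y ∈ cycleOf x
  reach⇒∈ {x} {y} c k eq with reduce f (returns c) k
  ... | r , r<n , eq′ =
    subst₂ _∈_ (trans (sym (iter-ext f≗ r x)) (trans (sym eq′) eq)) (sym (cycle-orbit fast x)) (iter-∈-orbit fast x r<n)

  ∈⇒reach : ∀ {x y} → y ∈ cycleOf x → Σ ℕ λ r → r < suc (period fast x) × iter f r x ≡ y
  ∈⇒reach {x} {y} y∈ with ∈-orbit-iter fast (subst (y ∈_) (cycle-orbit fast x) y∈)
  ... | r , r<n , eq = r , r<n , trans (iter-ext f≗ r x) eq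

  ∈⇒SameOrbit : ∀ {x y} → Closed x → y ∈ cycleOf x → SameOrbit M f x y
  ∈⇒SameOrbit {x} c y∈ with ∈⇒reach y∈
  ... | r , r<n , eq = fromℕ< r<N , trans (cong (λ n → iter f n x) (toℕ-fromℕ< r<N)) eq
    where r<N = ≤-trans r<n (length≤N c)

  SameOrbit⇒∈ : ∀ {x y} → Closed x → SameOrbit M f x y → y ∈ cycleOf x
  SameOrbit⇒∈ c (k , eq) = reach⇒∈ c (toℕ k) eq

  reach⇒SameOrbit : ∀ {x y} → Closed x → ∀ k → iter f k x ≡ y → SameOrbit M f x y
  reach⇒SameOrbit c k eq = ∈⇒SameOrbit c (reach⇒∈ c k eq)

  SameOrbit-trans : ∀ {x y z} → Closed x → SameOrbit M f x y → SameOrbit M f y z → SameOrbit M f x z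
  SameOrbit-trans {x} c (k , eq) (l , eq′) =
    reach⇒SameOrbit c (toℕ l + toℕ k) (trans (iter-+ f (toℕ l) (toℕ k) x) (trans (cong (iter f (toℕ l)) eq) eq′))

  SameOrbit-sym : ∀ {x y} → Closed x → Closed y → SameOrbit M f x y → SameOrbit M f y x
  SameOrbit-sym {x} {y} cx cy s with ∈⇒reach (SameOrbit⇒∈ cx s)
  ... | r , r<n , eq = reach⇒SameOrbit cy (n ∸ r) (begin
      iter f (n ∸ r) y                ≡⟨ cong (iter f (n ∸ r)) (sym eq) ⟩
      iter f (n ∸ r) (iter f r x)     ≡⟨ sym (iter-+ f (n ∸ r) r x) ⟩
      iter f (n ∸ r + r) x            ≡⟨ cong (λ m → iter f m x) (m∸n+n≡m (<⇒≤ r<n)) ⟩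
      iter f n x                      ≡⟨ returns cx ⟩
      x                               ∎)
    where
    open ≡-Reasoning
    n = suc (period fast x)

module _ {N : ℕ} {M : PreMap N} where

  Connected-trans : ∀ {x y z} → Connected M x y → Connected M y z → Connected M x z
  Connected-trans here q = q
  Connected-trans (viaα p) q = viaα (Connected-trans p q)
  Connected-trans (viaσ p) q = viaσ (Connected-trans p q)

  Connected-σ^ : ∀ k x → Connected M x (iter (σ M) k x)
  Connected-σ^ zero x = here
  Connected-σ^ (suc k) x =
    viaσ (subst (Connected M (σ M x)) (sym (iter-suc (σ M) k x)) (Connected-σ^ k (σ M x)))

  -- When α is an involution and every dart returns to itself under σ, each
  -- step of a walk can be undone, so Connected is symmetric.
  Connected-sym : (∀ x → α M (α M x) ≡ x) → (∀ x → Σ ℕ λ k → iter (σ M) (suc k) x ≡ x) →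
                  ∀ {x y} → Connected M x y → Connected M y x
  Connected-sym inv ret here = here
  Connected-sym inv ret (viaα {x} p) =
    Connected-trans (Connected-sym inv ret p) (viaα (subst (λ z → Connected M z x) (sym (inv x)) here))
  Connected-sym inv ret (viaσ {x} p) with ret x
  ... | k , σ^1+k≡id =
    Connected-trans (Connected-sym inv ret p)
      (subst (Connected M (σ M x)) (trans (sym (iter-suc (σ M) k x)) σ^1+k≡id) (Connected-σ^ k (σ M x)))

not-meet : ∀ {N} (M : PreMap N) {x y p₁ q₁ p₂ q₂} →
           CommonVertex M x y p₁ q₁ → CommonVertex M x y p₂ q₂ →
           (∀ z → SameVertex M p₁ z → ¬ SameVertex M p₂ z) → (∀ x′ → ¬ SharedEdge M x y x′) →
           ¬ MeetProperly M x y
not-meet M cv₁ cv₂ apart noEdge (inj₁ disjoint) = disjoint _ _ cv₁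
not-meet M cv₁ cv₂ apart noEdge (inj₂ (inj₁ (x₀ , _ , _ , only , _))) = apart x₀ (only _ _ cv₁) (only _ _ cv₂)
not-meet M cv₁ cv₂ apart noEdge (inj₂ (inj₂ (x₀ , shared , _))) = noEdge x₀ shared

MeetProperly-resp : ∀ {N} (M : PreMap N) {x y x′ y′} →
                    (∀ z → SameFace M x z ⇔ SameFace M x′ z) → (∀ z → SameFace M y z ⇔ SameFace M y′ z) →
                    MeetProperly M x′ y′ → MeetProperly M x y
MeetProperly-resp M {x} {y} {x′} {y′} x~x′ y~y′ = resp
  where
  open Equivalence
  cv⁺ : ∀ {u v} → CommonVertex M x y u v → CommonVertex M x′ y′ u v
  cv⁺ (fx , fy , s) = to (x~x′ _) fx , to (y~y′ _) fy , s
  cv⁻ : ∀ {u v} → CommonVertex M x′ y′ u v → CommonVertex M x y u v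
  cv⁻ (fx , fy , s) = from (x~x′ _) fx , from (y~y′ _) fy , s
  se⁺ : ∀ {u} → SharedEdge M x y u → SharedEdge M x′ y′ u
  se⁺ (fx , fy) = to (x~x′ _) fx , to (y~y′ _) fy
  se⁻ : ∀ {u} → SharedEdge M x′ y′ u → SharedEdge M x y u
  se⁻ (fx , fy) = from (x~x′ _) fx , from (y~y′ _) fy
  resp : MeetProperly M x′ y′ → MeetProperly M x y
  resp (inj₁ disjoint) = inj₁ λ u v cv → disjoint u v (cv⁺ cv)
  resp (inj₂ (inj₁ (x₀ , y₀ , cv₀ , only , noEdge))) =
    inj₂ (inj₁ (x₀ , y₀ , cv⁻ cv₀ , (λ u v cv → only u v (cv⁺ cv)) , λ u e → noEdge u (se⁺ e)))
  resp (inj₂ (inj₂ (x₀ , e₀ , unique , only))) =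
    inj₂ (inj₂ (x₀ , se⁻ e₀ , (λ u e → unique u (se⁺ e)) , λ u v cv → only u v (cv⁺ cv)))
-- A certificate that a map is not a TPM: darts x and y on two different faces,
-- which meet at the vertex of p₁ (on the face of x) and q₁ (on the face of y),
-- and at the different vertex of p₂ and q₂, but share no edge.
record Obstruction (N : ℕ) : Set where
  constructor obstruction
  field
    x y p₁ q₁ p₂ q₂ : Fin N

module Presentation {N : ℕ} (M : PreMap N) (αF σF : Fin N → Fin N)
                    (α≗ : ∀ z → α M z ≡ αF z) (σ≗ : ∀ z → σ M z ≡ σF z) where

  φF : Fin N → Fin N
  φF z = σF (αF z)

  φ≗ : ∀ z → φ M z ≡ φF z
  φ≗ z = trans (cong (σ M) (α≗ z)) (σ≗ (αF z))

  module V = CycleList M (σ M) σF σ≗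
  module F = CycleList M (φ M) φF φ≗

  vertexOf faceOf : Fin N → List (Fin N)
  vertexOf = V.cycleOf
  faceOf = F.cycleOf

  module _ {x y : Fin N} (cx : F.Closed x) (cy : F.Closed y) where

    commonVertex⇒ : ∀ {u v} → V.Closed u → CommonVertex M x y u v →
                    u ∈ faceOf x × v ∈ faceOf y × v ∈ vertexOf u
    commonVertex⇒ cu (fu , fv , s) = F.SameOrbit⇒∈ cx fu , F.SameOrbit⇒∈ cy fv , V.SameOrbit⇒∈ cu s

    ⇒commonVertex : ∀ {u v} → V.Closed u → u ∈ faceOf x → v ∈ faceOf y → v ∈ vertexOf u →
                    CommonVertex M x y u v
    ⇒commonVertex cu u∈ v∈ s = F.∈⇒SameOrbit cx u∈ , F.∈⇒SameOrbit cy v∈ , V.∈⇒SameOrbit cu s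

    sharedEdge⇒ : ∀ {u} → SharedEdge M x y u → u ∈ faceOf x × αF u ∈ faceOf y
    sharedEdge⇒ {u} (fu , fαu) = F.SameOrbit⇒∈ cx fu , subst (_∈ faceOf y) (α≗ u) (F.SameOrbit⇒∈ cy fαu)

    ⇒sharedEdge : ∀ {u} → u ∈ faceOf x → αF u ∈ faceOf y → SharedEdge M x y u
    ⇒sharedEdge {u} u∈ αu∈ = F.∈⇒SameOrbit cx u∈ , subst (SameFace M y) (sym (α≗ u)) (F.∈⇒SameOrbit cy αu∈)

  -- The checks below take the face and vertex lists as arguments, so that
  -- evaluation computes each list once.

  noSharedEdgeᵇ : List (Fin N) → List (Fin N) → Bool
  noSharedEdgeᵇ Fx Fy = all (λ u → not (αF u ∈ᵇ Fy)) Fx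

  noSharedEdge-sound : ∀ {x y} → F.Closed x → F.Closed y → T (noSharedEdgeᵇ (faceOf x) (faceOf y)) →
                       ∀ u → ¬ SharedEdge M x y u
  noSharedEdge-sound {x} {y} cx cy t u e with sharedEdge⇒ cx cy e
  ... | u∈ , αu∈ = not-elim (all-elim (λ u → not (αF u ∈ᵇ faceOf y)) t u∈) (∈ᵇ-complete αu∈)

  distinctFacesᵇ : Fin N → Fin N → List (Fin N) → List (Fin N) → Bool
  distinctFacesᵇ x y Fx Fy = live M x ∧ live M y ∧ F.closedᵇ x Fx ∧ F.closedᵇ y Fy ∧ not (y ∈ᵇ Fx)

  commonVertexᵇ : Fin N → Fin N → List (Fin N) → List (Fin N) → List (Fin N) → Bool
  commonVertexᵇ p q Fx Fy Vp = p ∈ᵇ Fx ∧ q ∈ᵇ Fy ∧ V.closedᵇ p Vp ∧ q ∈ᵇ Vp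

  apartᵇ : List (Fin N) → List (Fin N) → Bool
  apartᵇ V₁ V₂ = all (λ w → not (w ∈ᵇ V₁)) V₂

  obstructionOn : (x y p₁ q₁ p₂ q₂ : Fin N) (Fx Fy V₁ V₂ : List (Fin N)) → Bool
  obstructionOn x y p₁ q₁ p₂ q₂ Fx Fy V₁ V₂ =
    distinctFacesᵇ x y Fx Fy ∧ commonVertexᵇ p₁ q₁ Fx Fy V₁ ∧ commonVertexᵇ p₂ q₂ Fx Fy V₂
    ∧ apartᵇ V₁ V₂ ∧ noSharedEdgeᵇ Fx Fy

  obstructionᵇ : Obstruction N → Bool
  obstructionᵇ (obstruction x y p₁ q₁ p₂ q₂) =
    obstructionOn x y p₁ q₁ p₂ q₂ (faceOf x) (faceOf y) (vertexOf p₁) (vertexOf p₂)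

  commonVertex-sound : ∀ {x y} p q → F.Closed x → F.Closed y →
                       T (commonVertexᵇ p q (faceOf x) (faceOf y) (vertexOf p)) → V.Closed p × CommonVertex M x y p q
  commonVertex-sound p q cx cy t =
    let p∈ , t = ∧-elim t
        q∈ , t = ∧-elim t
        cp , s = ∧-elim t
    in cp , ⇒commonVertex cx cy cp (∈ᵇ-sound p∈) (∈ᵇ-sound q∈) (∈ᵇ-sound s)

  apart-sound : ∀ p₁ p₂ → V.Closed p₁ → V.Closed p₂ → T (apartᵇ (vertexOf p₁) (vertexOf p₂)) →
                ∀ z → SameVertex M p₁ z → ¬ SameVertex M p₂ z
  apart-sound p₁ p₂ c₁ c₂ t z s₁ s₂ =
    not-elim (all-elim (λ w → not (w ∈ᵇ vertexOf p₁)) t (V.SameOrbit⇒∈ c₂ s₂)) (∈ᵇ-complete (V.SameOrbit⇒∈ c₁ s₁))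

  obstruction-sound : ∀ o → T (obstructionᵇ o) → ¬ IsTPM M
  obstruction-sound (obstruction x y p₁ q₁ p₂ q₂) t tpm =
    let faces , t = ∧-elim {distinctFacesᵇ x y (faceOf x) (faceOf y)} t
        at₁ , t = ∧-elim {commonVertexᵇ p₁ q₁ (faceOf x) (faceOf y) (vertexOf p₁)} t
        at₂ , t = ∧-elim {commonVertexᵇ p₂ q₂ (faceOf x) (faceOf y) (vertexOf p₂)} t
        apart , noEdge = ∧-elim {apartᵇ (vertexOf p₁) (vertexOf p₂)} t
        lx , faces = ∧-elim {live M x} faces
        ly , faces = ∧-elim {live M y} faces
        cx , faces = ∧-elim {F.closedᵇ x (faceOf x)} faces
        cy , y∉ = ∧-elim {F.closedᵇ y (faceOf y)} faces
        c₁ , cv₁ = commonVertex-sound p₁ q₁ cx cy at₁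
        c₂ , cv₂ = commonVertex-sound p₂ q₂ cx cy at₂
        x≁y = λ s → not-elim y∉ (∈ᵇ-complete (F.SameOrbit⇒∈ cx s))
    in not-meet M cv₁ cv₂ (apart-sound p₁ p₂ c₁ c₂ apart) (noSharedEdge-sound cx cy noEdge)
                (IsTPM.faces-meet-properly tpm x y lx ly x≁y)

obstructs : ∀ {N} → PreMap N → Obstruction N → Bool
obstructs M = Presentation.obstructionᵇ M (α M) (σ M) (λ _ → refl) (λ _ → refl)

obstructs-sound : ∀ {N} (M : PreMap N) o → T (obstructs M o) → ¬ IsTPM M
obstructs-sound M = Presentation.obstruction-sound M (α M) (σ M) (λ _ → refl) (λ _ → refl)

data Move : Set where
  α-hop σ-hop : Move

module Criterion {N : ℕ} (M : PreMap N) (αF σF : Fin N → Fin N)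
                 (α≗ : ∀ z → α M z ≡ αF z) (σ≗ : ∀ z → σ M z ≡ σF z) where

  open Presentation M αF σF α≗ σ≗

  allPairsᵇ : List (Fin N) → List (Fin N) → (Fin N → Fin N → Bool) → Bool
  allPairsᵇ Fx Fy p = all (λ u → all (p u) Fy) Fx

  sameVertexᵇ : Fin N → Fin N → Bool
  sameVertexᵇ u v = v ∈ᵇ vertexOf u

  disjointᵇ : List (Fin N) → List (Fin N) → Bool
  disjointᵇ Fx Fy = allPairsᵇ Fx Fy λ u v → not (sameVertexᵇ u v)

  onlyVertexAtᵇ : List (Fin N) → List (Fin N) → Fin N → Bool
  onlyVertexAtᵇ Fx Fy u₀ =
    any (sameVertexᵇ u₀) Fy ∧ allPairsᵇ Fx Fy λ u v → sameVertexᵇ u v ⇒ᵇ sameVertexᵇ u u₀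

  oneVertexᵇ : List (Fin N) → List (Fin N) → Bool
  oneVertexᵇ Fx Fy = noSharedEdgeᵇ Fx Fy ∧ any (onlyVertexAtᵇ Fx Fy) Fx

  onlyEdgeAtᵇ : List (Fin N) → List (Fin N) → Fin N → Bool
  onlyEdgeAtᵇ Fx Fy u₀ =
    αF u₀ ∈ᵇ Fy ∧ all (λ u → αF u ∈ᵇ Fy ⇒ᵇ u == u₀) Fx
    ∧ allPairsᵇ Fx Fy λ u v → sameVertexᵇ u v ⇒ᵇ sameVertexᵇ u u₀ ∨ sameVertexᵇ u (αF u₀)

  oneEdgeᵇ : List (Fin N) → List (Fin N) → Bool
  oneEdgeᵇ Fx Fy = any (onlyEdgeAtᵇ Fx Fy) Fx

  meetᵇ : List (Fin N) → List (Fin N) → Bool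
  meetᵇ Fx Fy = disjointᵇ Fx Fy ∨ oneVertexᵇ Fx Fy ∨ oneEdgeᵇ Fx Fy

  module _ (vc : ∀ z → V.Closed z) {x y : Fin N} (cx : F.Closed x) (cy : F.Closed y) where

    allPairs-elim : ∀ p {u v} → T (allPairsᵇ (faceOf x) (faceOf y) p) → u ∈ faceOf x → v ∈ faceOf y → T (p u v)
    allPairs-elim p {u} t u∈ v∈ = all-elim (p u) (all-elim (λ u → all (p u) (faceOf y)) t u∈) v∈

    common : ∀ {u v} → CommonVertex M x y u v → u ∈ faceOf x × v ∈ faceOf y × T (sameVertexᵇ u v)
    common {u} cv = let u∈ , v∈ , s = commonVertex⇒ cx cy (vc u) cv in u∈ , v∈ , ∈ᵇ-complete s

    sameVertex-sound : ∀ u {v} → T (sameVertexᵇ u v) → SameVertex M u v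
    sameVertex-sound u s = V.∈⇒SameOrbit (vc u) (∈ᵇ-sound s)

    atEnd : ∀ u u₀ → T (sameVertexᵇ u u₀ ∨ sameVertexᵇ u (αF u₀)) → SameVertex M u u₀ ⊎ SameVertex M u (α M u₀)
    atEnd u u₀ t with ∨-elim {sameVertexᵇ u u₀} t
    ... | inj₁ s = inj₁ (sameVertex-sound u s)
    ... | inj₂ s = inj₂ (subst (SameVertex M u) (sym (α≗ u₀)) (sameVertex-sound u s))

    disjoint-sound : T (disjointᵇ (faceOf x) (faceOf y)) → MeetProperly M x y
    disjoint-sound t = inj₁ λ u v cv → let u∈ , v∈ , s = common cv in not-elim (allPairs-elim _ t u∈ v∈) s

    oneVertex-sound : T (oneVertexᵇ (faceOf x) (faceOf y)) → MeetProperly M x y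
    oneVertex-sound t =
      let noEdge , t = ∧-elim {noSharedEdgeᵇ (faceOf x) (faceOf y)} t
          u₀ , u₀∈ , t = any-elim (onlyVertexAtᵇ (faceOf x) (faceOf y)) t
          hasVertex , only = ∧-elim {any (sameVertexᵇ u₀) (faceOf y)} t
          v₀ , v₀∈ , s₀ = any-elim (sameVertexᵇ u₀) hasVertex
      in inj₂ (inj₁ (u₀ , v₀ , ⇒commonVertex cx cy (vc u₀) u₀∈ v₀∈ (∈ᵇ-sound s₀)
                    , (λ u v cv → let u∈ , v∈ , s = common cv
                                  in sameVertex-sound u (⇒ᵇ-elim (allPairs-elim _ only u∈ v∈) s))
                    , noSharedEdge-sound cx cy noEdge))

    oneEdge-sound : T (oneEdgeᵇ (faceOf x) (faceOf y)) → MeetProperly M x y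
    oneEdge-sound t =
      let u₀ , u₀∈ , t = any-elim (onlyEdgeAtᵇ (faceOf x) (faceOf y)) t
          borders , t = ∧-elim {αF u₀ ∈ᵇ faceOf y} t
          unique , only = ∧-elim {all (λ u → αF u ∈ᵇ faceOf y ⇒ᵇ u == u₀) (faceOf x)} t
      in inj₂ (inj₂ (u₀ , ⇒sharedEdge cx cy u₀∈ (∈ᵇ-sound borders)
                    , (λ u e → let u∈ , αu∈ = sharedEdge⇒ cx cy e
                               in ==-sound (⇒ᵇ-elim (all-elim (λ u → αF u ∈ᵇ faceOf y ⇒ᵇ u == u₀) unique u∈) (∈ᵇ-complete αu∈)))
                    , (λ u v cv → let u∈ , v∈ , s = common cv
                                  in atEnd u u₀ (⇒ᵇ-elim (allPairs-elim _ only u∈ v∈) s))))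

    meet-sound : T (meetᵇ (faceOf x) (faceOf y)) → MeetProperly M x y
    meet-sound t = [ disjoint-sound , [ oneVertex-sound , oneEdge-sound ] ∘ ∨-elim ] (∨-elim t)

  move : Move → Fin N → Fin N
  move α-hop = αF
  move σ-hop = σF

  Connected-move : ∀ m x → Connected M x (move m x)
  Connected-move α-hop x = viaα (subst (Connected M (α M x)) (α≗ x) here)
  Connected-move σ-hop x = viaσ (subst (Connected M (σ M x)) (σ≗ x) here)

  follow : (Fin N → Move) → Fin N → Fin N
  follow hop z = move (hop z) z

  -- x is the least dart of its face; meeting properly is checked only for such darts.
  leastᵇ : Fin N → Bool
  leastᵇ x = all (λ u → toℕ x ≤ᵇ toℕ u) (faceOf x)

  record Checks (root : Fin N) (hop : Fin N → Move) : Set where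
    field
      closed     : T (everyDart λ x → V.closedᵇ x (vertexOf x) ∧ F.closedᵇ x (faceOf x))
      involution : T (everyDart λ x → (αF (αF x) == x) ∧ not (αF x == x))
      injective  : T (everyDart λ x → everyDart λ y → σF x == σF y ⇒ᵇ x == y)
      degree≥3   : T (everyDart λ x → not (σF x == x) ∧ not (σF (σF x) == x))
      loopless   : T (everyDart λ x → not (sameVertexᵇ x (αF x)))
      no-multi   : T (everyDart λ x → all (λ y → sameVertexᵇ (αF x) (αF y) ⇒ᵇ x == y) (vertexOf x))
      cellular   : T (everyDart λ x → all (λ y → sameVertexᵇ x y ⇒ᵇ x == y) (faceOf x))
      to-root    : T (everyDart λ x → root ∈ᵇ orbit (follow hop) N x)
      has-least  : T (everyDart λ x → any leastᵇ (faceOf x))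
      proper     : T (everyDart λ x → everyDart λ y →
                        leastᵇ x ∧ leastᵇ y ⇒ᵇ y ∈ᵇ faceOf x ∨ meetᵇ (faceOf x) (faceOf y))

  module Derivation {root : Fin N} {hop : Fin N → Move} (checks : Checks root hop) where
    open Checks checks

    vc : ∀ x → V.Closed x
    vc x = proj₁ (∧-elim {V.closedᵇ x (vertexOf x)} (everyDart-elim _ closed x))

    fc : ∀ x → F.Closed x
    fc x = proj₂ (∧-elim {V.closedᵇ x (vertexOf x)} (everyDart-elim _ closed x))

    involutive : ∀ x → α M (α M x) ≡ x
    involutive x = trans (trans (cong (α M) (α≗ x)) (α≗ (αF x)))
                         (==-sound (proj₁ (∧-elim {αF (αF x) == x} (everyDart-elim _ involution x))))

    fixpoint-free : ∀ x → α M x ≢ x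
    fixpoint-free x eq = not-elim (proj₂ (∧-elim {αF (αF x) == x} (everyDart-elim _ involution x)))
                                  (==-complete (trans (sym (α≗ x)) eq))

    σ-injective : ∀ x y → σ M x ≡ σ M y → x ≡ y
    σ-injective x y eq = ==-sound (⇒ᵇ-elim (everyDart-elim _ (everyDart-elim _ injective x) y)
                                           (==-complete (trans (sym (σ≗ x)) (trans eq (σ≗ y)))))

    degree : ∀ x → (σ M x ≢ x) × (σ M (σ M x) ≢ x)
    degree x =
      let d₁ , d₂ = ∧-elim {not (σF x == x)} (everyDart-elim _ degree≥3 x)
      in (λ eq → not-elim d₁ (==-complete (trans (sym (σ≗ x)) eq)))
       , (λ eq → not-elim d₂ (==-complete (trans (sym (trans (cong (σ M) (σ≗ x)) (σ≗ (σF x)))) eq)))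

    no-loops : ∀ x → ¬ SameVertex M x (α M x)
    no-loops x s = not-elim (everyDart-elim _ loopless x)
                     (∈ᵇ-complete (subst (_∈ vertexOf x) (α≗ x) (V.SameOrbit⇒∈ (vc x) s)))

    no-multi-edges : ∀ x y → SameVertex M x y → SameVertex M (α M x) (α M y) → x ≡ y
    no-multi-edges x y s s′ =
      ==-sound (⇒ᵇ-elim (all-elim _ (everyDart-elim _ no-multi x) (V.SameOrbit⇒∈ (vc x) s))
                        (∈ᵇ-complete (subst₂ (λ u v → v ∈ vertexOf u) (α≗ x) (α≗ y) (V.SameOrbit⇒∈ (vc (α M x)) s′))))

    closed-cells : ∀ x y → SameFace M x y → SameVertex M x y → x ≡ y
    closed-cells x y f s =
      ==-sound (⇒ᵇ-elim (all-elim _ (everyDart-elim _ cellular x) (F.SameOrbit⇒∈ (fc x) f))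
                        (∈ᵇ-complete (V.SameOrbit⇒∈ (vc x) s)))

    walk : ∀ r x → Connected M x (iter (follow hop) r x)
    walk zero x = here
    walk (suc r) x = Connected-trans (walk r x) (Connected-move (hop _) _)

    reaches-root : ∀ x → Connected M x root
    reaches-root x with ∈-orbit-iter (follow hop) (∈ᵇ-sound {xs = orbit (follow hop) N x} (everyDart-elim _ to-root x))
    ... | r , _ , eq = subst (Connected M x) eq (walk r x)

    connected : ∀ x y → Connected M x y
    connected x y = Connected-trans (reaches-root x)
                      (Connected-sym involutive (λ z → period σF z , V.returns (vc z)) (reaches-root y))

    same-faces : ∀ {x x′} → SameFace M x x′ → ∀ z → SameFace M x z ⇔ SameFace M x′ z
    same-faces {x} {x′} s z = mk⇔ (F.SameOrbit-trans (fc x′) (F.SameOrbit-sym (fc x) (fc x′) s))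
                                  (F.SameOrbit-trans (fc x) s)

    -- reduce to the least darts x₀, y₀ of the two faces
    meets : ∀ x y → ¬ SameFace M x y → MeetProperly M x y
    meets x y x≁y
      with any-elim leastᵇ (everyDart-elim _ has-least x) | any-elim leastᵇ (everyDart-elim _ has-least y)
    ... | x₀ , x₀∈ , x₀-least | y₀ , y₀∈ , y₀-least
      with ∨-elim (⇒ᵇ-elim (everyDart-elim _ (everyDart-elim _ proper x₀) y₀) (∧-intro x₀-least y₀-least))
    ... | inj₁ y₀∈x₀ = ⊥-elim (x≁y (F.SameOrbit-trans (fc x) x~x₀
                          (F.SameOrbit-trans (fc x₀) (F.∈⇒SameOrbit (fc x₀) (∈ᵇ-sound y₀∈x₀))
                            (F.SameOrbit-sym (fc y) (fc y₀) y~y₀))))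
      where
      x~x₀ = F.∈⇒SameOrbit (fc x) x₀∈
      y~y₀ = F.∈⇒SameOrbit (fc y) y₀∈
    ... | inj₂ m = MeetProperly-resp M (same-faces (F.∈⇒SameOrbit (fc x) x₀∈)) (same-faces (F.∈⇒SameOrbit (fc y) y₀∈))
                     (meet-sound vc (fc x₀) (fc y₀) m)

  isTPM : (∀ x → Live M x) → #V M + #F M ≡ #E M → ∀ {root hop} → Checks root hop → IsTPM M
  isTPM all-live torus {root} checks = record
    { nonempty             = root , all-live root
    ; α-live               = λ x _ → all-live (α M x)
    ; σ-live               = λ x _ → all-live (σ M x)
    ; α-involution         = λ x _ → involutive x
    ; α-no-fixpoint        = λ x _ → fixpoint-free x
    ; σ-injective          = λ x y _ _ → σ-injective x y
    ; connected            = λ x y _ _ → connected x y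
    ; no-loops             = λ x _ → no-loops x
    ; no-multi-edges       = λ x y _ _ → no-multi-edges x y
    ; torus                = torus
    ; degree≥3             = λ x _ → degree x
    ; faces-closed-2-cells = λ x y _ → closed-cells x y
    ; faces-meet-properly  = λ x y _ _ → meets x y
    }
    where open Derivation checks

-- Dart 4v+i of S₁ is the i-th entry of the rotation at vertex v.  Its
-- permutations are tabulated for fast evaluation; the tables are checked
-- against S₁ itself.
αS₁ σS₁ : Fin 52 → Fin 52
αS₁ = lookup
  (  # 4 ∷ # 8 ∷ # 12 ∷ # 16 ∷ # 0 ∷ # 20 ∷ # 24 ∷ # 28 ∷ # 1 ∷ # 31 ∷ # 32 ∷ # 36 ∷ # 2
   ∷ # 39 ∷ # 40 ∷ # 44 ∷ # 3 ∷ # 47 ∷ # 48 ∷ # 21 ∷ # 5 ∷ # 19 ∷ # 37 ∷ # 35 ∷ # 6 ∷ # 34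
   ∷ # 49 ∷ # 46 ∷ # 7 ∷ # 45 ∷ # 43 ∷ # 9 ∷ # 10 ∷ # 42 ∷ # 25 ∷ # 23 ∷ # 11 ∷ # 22 ∷ # 51
   ∷ # 13 ∷ # 14 ∷ # 50 ∷ # 33 ∷ # 30 ∷ # 15 ∷ # 29 ∷ # 27 ∷ # 17 ∷ # 18 ∷ # 26 ∷ # 41 ∷ # 38 ∷ [])
σS₁ = lookup
  (  # 1 ∷ # 2 ∷ # 3 ∷ # 0 ∷ # 5 ∷ # 6 ∷ # 7 ∷ # 4 ∷ # 9 ∷ # 10 ∷ # 11 ∷ # 8 ∷ # 13
   ∷ # 14 ∷ # 15 ∷ # 12 ∷ # 17 ∷ # 18 ∷ # 19 ∷ # 16 ∷ # 21 ∷ # 22 ∷ # 23 ∷ # 20 ∷ # 25 ∷ # 26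
   ∷ # 27 ∷ # 24 ∷ # 29 ∷ # 30 ∷ # 31 ∷ # 28 ∷ # 33 ∷ # 34 ∷ # 35 ∷ # 32 ∷ # 37 ∷ # 38 ∷ # 39
   ∷ # 36 ∷ # 41 ∷ # 42 ∷ # 43 ∷ # 40 ∷ # 45 ∷ # 46 ∷ # 47 ∷ # 44 ∷ # 49 ∷ # 50 ∷ # 51 ∷ # 48 ∷ [])

α≗αS₁ : ∀ x → α S₁ x ≡ αS₁ x
α≗αS₁ = ==-sound ∘ everyDart-elim (λ x → α S₁ x == αS₁ x) _

σ≗σS₁ : ∀ x → σ S₁ x ≡ σS₁ x
σ≗σS₁ = ==-sound ∘ everyDart-elim (λ x → σ S₁ x == σS₁ x) _

-- From any dart turn (σ) to the first entry of its rotation, then cross (α) to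
-- the first neighbour; first neighbours lead from every vertex to a.
towardsA : Fin 52 → Move
towardsA x = if toℕ x % 4 ≡ᵇ 0 then α-hop else σ-hop

-- All checks, and V + F = E (13 + 13 = 26), hold by evaluation.
S₁-isTPM : IsTPM S₁
S₁-isTPM = Criterion.isTPM S₁ αS₁ σS₁ α≗αS₁ σ≗σS₁ (λ _ → _) refl {root = # 0} {hop = towardsA} record
  { closed = _ ; involution = _ ; injective = _ ; degree≥3 = _ ; loopless = _ ; no-multi = _
  ; cellular = _ ; to-root = _ ; has-least = _ ; proper = _ }

-- Entry d obstructs removing, respectively shrinking, the edge of dart d.
removalObstructions : Vec (Obstruction 52) 52
removalObstructions =
  ( obstruction (# 1) (# 11) (# 9) (# 11) (# 21) (# 23)
  ∷ obstruction (# 2) (# 15) (# 13) (# 15) (# 28) (# 30)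
  ∷ obstruction (# 3) (# 19) (# 36) (# 38) (# 17) (# 19)
  ∷ obstruction (# 0) (# 7) (# 5) (# 7) (# 44) (# 46)
  ∷ obstruction (# 1) (# 11) (# 9) (# 11) (# 21) (# 23)
  ∷ obstruction (# 0) (# 18) (# 16) (# 18) (# 25) (# 27)
  ∷ obstruction (# 7) (# 10) (# 35) (# 33) (# 29) (# 31)
  ∷ obstruction (# 1) (# 3) (# 1) (# 3) (# 46) (# 44)
  ∷ obstruction (# 2) (# 15) (# 13) (# 15) (# 28) (# 30)
  ∷ obstruction (# 1) (# 6) (# 33) (# 35) (# 4) (# 6)
  ∷ obstruction (# 11) (# 14) (# 37) (# 39) (# 43) (# 41)
  ∷ obstruction (# 0) (# 2) (# 0) (# 2) (# 21) (# 23)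
  ∷ obstruction (# 3) (# 19) (# 36) (# 38) (# 17) (# 19)
  ∷ obstruction (# 2) (# 10) (# 8) (# 10) (# 41) (# 43)
  ∷ obstruction (# 15) (# 18) (# 45) (# 47) (# 51) (# 49)
  ∷ obstruction (# 1) (# 3) (# 1) (# 3) (# 28) (# 30)
  ∷ obstruction (# 0) (# 7) (# 5) (# 7) (# 44) (# 46)
  ∷ obstruction (# 3) (# 14) (# 12) (# 14) (# 49) (# 51)
  ∷ obstruction (# 6) (# 19) (# 25) (# 27) (# 20) (# 22)
  ∷ obstruction (# 0) (# 2) (# 0) (# 2) (# 38) (# 36)
  ∷ obstruction (# 0) (# 18) (# 16) (# 18) (# 25) (# 27)
  ∷ obstruction (# 0) (# 2) (# 0) (# 2) (# 38) (# 36)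
  ∷ obstruction (# 11) (# 26) (# 32) (# 34) (# 48) (# 50)
  ∷ obstruction (# 1) (# 6) (# 4) (# 6) (# 9) (# 11)
  ∷ obstruction (# 7) (# 10) (# 35) (# 33) (# 29) (# 31)
  ∷ obstruction (# 6) (# 19) (# 50) (# 48) (# 20) (# 22)
  ∷ obstruction (# 15) (# 18) (# 40) (# 42) (# 45) (# 47)
  ∷ obstruction (# 0) (# 7) (# 16) (# 18) (# 5) (# 7)
  ∷ obstruction (# 1) (# 3) (# 1) (# 3) (# 46) (# 44)
  ∷ obstruction (# 7) (# 26) (# 40) (# 42) (# 24) (# 26)
  ∷ obstruction (# 2) (# 10) (# 8) (# 10) (# 13) (# 15)
  ∷ obstruction (# 1) (# 6) (# 33) (# 35) (# 4) (# 6)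
  ∷ obstruction (# 11) (# 14) (# 37) (# 39) (# 43) (# 41)
  ∷ obstruction (# 7) (# 10) (# 24) (# 26) (# 29) (# 31)
  ∷ obstruction (# 6) (# 19) (# 50) (# 48) (# 20) (# 22)
  ∷ obstruction (# 1) (# 6) (# 4) (# 6) (# 9) (# 11)
  ∷ obstruction (# 0) (# 2) (# 0) (# 2) (# 21) (# 23)
  ∷ obstruction (# 11) (# 26) (# 32) (# 34) (# 48) (# 50)
  ∷ obstruction (# 3) (# 14) (# 17) (# 19) (# 12) (# 14)
  ∷ obstruction (# 2) (# 10) (# 8) (# 10) (# 41) (# 43)
  ∷ obstruction (# 15) (# 18) (# 45) (# 47) (# 51) (# 49)
  ∷ obstruction (# 11) (# 14) (# 32) (# 34) (# 37) (# 39)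
  ∷ obstruction (# 7) (# 10) (# 24) (# 26) (# 29) (# 31)
  ∷ obstruction (# 2) (# 10) (# 8) (# 10) (# 13) (# 15)
  ∷ obstruction (# 1) (# 3) (# 1) (# 3) (# 28) (# 30)
  ∷ obstruction (# 7) (# 26) (# 40) (# 42) (# 24) (# 26)
  ∷ obstruction (# 0) (# 7) (# 16) (# 18) (# 5) (# 7)
  ∷ obstruction (# 3) (# 14) (# 12) (# 14) (# 49) (# 51)
  ∷ obstruction (# 6) (# 19) (# 25) (# 27) (# 20) (# 22)
  ∷ obstruction (# 15) (# 18) (# 40) (# 42) (# 45) (# 47)
  ∷ obstruction (# 11) (# 14) (# 32) (# 34) (# 37) (# 39)
  ∷ obstruction (# 3) (# 14) (# 17) (# 19) (# 12) (# 14)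
  ∷ [])

shrinkingObstructions : Vec (Obstruction 52) 52
shrinkingObstructions =
  ( obstruction (# 3) (# 7) (# 3) (# 7) (# 44) (# 46)
  ∷ obstruction (# 0) (# 11) (# 0) (# 11) (# 21) (# 23)
  ∷ obstruction (# 1) (# 15) (# 1) (# 15) (# 28) (# 30)
  ∷ obstruction (# 2) (# 19) (# 2) (# 19) (# 36) (# 38)
  ∷ obstruction (# 3) (# 7) (# 3) (# 7) (# 44) (# 46)
  ∷ obstruction (# 1) (# 11) (# 4) (# 23) (# 9) (# 11)
  ∷ obstruction (# 0) (# 18) (# 16) (# 18) (# 5) (# 27)
  ∷ obstruction (# 6) (# 10) (# 35) (# 33) (# 6) (# 31)
  ∷ obstruction (# 0) (# 11) (# 0) (# 11) (# 21) (# 23)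
  ∷ obstruction (# 2) (# 15) (# 8) (# 30) (# 13) (# 15)
  ∷ obstruction (# 1) (# 6) (# 4) (# 6) (# 9) (# 35)
  ∷ obstruction (# 10) (# 14) (# 10) (# 39) (# 43) (# 41)
  ∷ obstruction (# 1) (# 15) (# 1) (# 15) (# 28) (# 30)
  ∷ obstruction (# 3) (# 19) (# 17) (# 19) (# 12) (# 38)
  ∷ obstruction (# 2) (# 10) (# 8) (# 10) (# 13) (# 43)
  ∷ obstruction (# 14) (# 18) (# 51) (# 49) (# 14) (# 47)
  ∷ obstruction (# 2) (# 19) (# 2) (# 19) (# 36) (# 38)
  ∷ obstruction (# 0) (# 7) (# 16) (# 46) (# 5) (# 7)
  ∷ obstruction (# 3) (# 14) (# 17) (# 51) (# 12) (# 14)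
  ∷ obstruction (# 6) (# 18) (# 25) (# 27) (# 20) (# 18)
  ∷ obstruction (# 1) (# 11) (# 4) (# 23) (# 9) (# 11)
  ∷ obstruction (# 6) (# 18) (# 25) (# 27) (# 20) (# 18)
  ∷ obstruction (# 0) (# 2) (# 0) (# 2) (# 21) (# 36)
  ∷ obstruction (# 19) (# 26) (# 48) (# 50) (# 22) (# 34)
  ∷ obstruction (# 0) (# 18) (# 16) (# 18) (# 5) (# 27)
  ∷ obstruction (# 7) (# 10) (# 24) (# 33) (# 29) (# 31)
  ∷ obstruction (# 6) (# 19) (# 25) (# 48) (# 20) (# 22)
  ∷ obstruction (# 15) (# 26) (# 40) (# 42) (# 45) (# 26)
  ∷ obstruction (# 6) (# 10) (# 35) (# 33) (# 6) (# 31)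
  ∷ obstruction (# 1) (# 3) (# 1) (# 3) (# 28) (# 44)
  ∷ obstruction (# 7) (# 26) (# 24) (# 26) (# 29) (# 42)
  ∷ obstruction (# 2) (# 15) (# 8) (# 30) (# 13) (# 15)
  ∷ obstruction (# 1) (# 6) (# 4) (# 6) (# 9) (# 35)
  ∷ obstruction (# 11) (# 14) (# 32) (# 41) (# 37) (# 39)
  ∷ obstruction (# 7) (# 10) (# 24) (# 33) (# 29) (# 31)
  ∷ obstruction (# 19) (# 26) (# 48) (# 50) (# 22) (# 34)
  ∷ obstruction (# 10) (# 14) (# 10) (# 39) (# 43) (# 41)
  ∷ obstruction (# 0) (# 2) (# 0) (# 2) (# 21) (# 36)
  ∷ obstruction (# 11) (# 26) (# 32) (# 34) (# 37) (# 50)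
  ∷ obstruction (# 3) (# 19) (# 17) (# 19) (# 12) (# 38)
  ∷ obstruction (# 2) (# 10) (# 8) (# 10) (# 13) (# 43)
  ∷ obstruction (# 15) (# 18) (# 40) (# 49) (# 45) (# 47)
  ∷ obstruction (# 11) (# 14) (# 32) (# 41) (# 37) (# 39)
  ∷ obstruction (# 7) (# 26) (# 24) (# 26) (# 29) (# 42)
  ∷ obstruction (# 14) (# 18) (# 51) (# 49) (# 14) (# 47)
  ∷ obstruction (# 1) (# 3) (# 1) (# 3) (# 28) (# 44)
  ∷ obstruction (# 15) (# 26) (# 40) (# 42) (# 45) (# 26)
  ∷ obstruction (# 0) (# 7) (# 16) (# 46) (# 5) (# 7)
  ∷ obstruction (# 3) (# 14) (# 17) (# 51) (# 12) (# 14)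
  ∷ obstruction (# 6) (# 19) (# 25) (# 48) (# 20) (# 22)
  ∷ obstruction (# 15) (# 18) (# 40) (# 49) (# 45) (# 47)
  ∷ obstruction (# 11) (# 26) (# 32) (# 34) (# 37) (# 50)
  ∷ [])

not-removable : ∀ d → ¬ Removable S₁ d
not-removable d = obstructs-sound (removeEdge S₁ d) (lookup removalObstructions d)
  (everyDart-elim (λ d → obstructs (removeEdge S₁ d) (lookup removalObstructions d)) _ d)

not-shrinkable : ∀ d → ¬ Shrinkable S₁ d
not-shrinkable d = obstructs-sound (shrinkEdge S₁ d) (lookup shrinkingObstructions d)
  (everyDart-elim (λ d → obstructs (shrinkEdge S₁ d) (lookup shrinkingObstructions d)) _ d)

mainTheorem1 : IsTPM S₁ × Diminimal S₁
mainTheorem1 = S₁-isTPM , (λ d _ → not-removable d) , (λ d _ → not-shrinkable d)
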